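{- Let $m \ge 3$, $r\ge 1$ be integers with $m \le 2r$. Then $\operatorname{Z}(Wb(m,r)) \le m$.
   Context: The web graph $Wb(m,r)$ is obtained from the Cartesian product $C_m \Box P_r$, with vertices $v_{i,j}$ ($i\in[m]$, $j\in[r]$), where $v_{i,j_1}\sim v_{i,j_2}$ iff $|j_1-j_2|=1$ and $v_{i_1,j}\sim v_{i_2,j}$ iff $|i_1-i_2|=1$ or $\{i_1,i_2\}=\{1,m\}$, by adding pendant vertices $p_1,\dots,p_m$ with $p_i$ adjacent only to $v_{i,1}$. Zero forcing: a blue vertex with exactly one white neighbor may color that neighbor blue; a zero forcing set is an initial blue set from which repeated application colors all vertices blue; $\operatorname{Z}(G)$ is the minimum size of a zero forcing set. -}

module Defs where

open import Data.Nat using (ℕ; zero; suc; _+_; _≤_)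
open import Data.Fin using (Fin; toℕ)
open import Data.Fin.Base using ()
open import Data.Bool using (Bool; true; false; if_then_else_)
open import Data.List using (List; []; _∷_; _++_; map; concatMap; allFin)
open import Data.Product using (Σ; _×_; _,_; ∃)
open import Data.Sum using (_⊎_; inj₁; inj₂)
open import Data.Empty using (⊥)
open import Relation.Binary.PropositionalEquality using (_≡_; _≢_)
open import Relation.Binary.Construct.Closure.ReflexiveTransitive using (Star)
open import Function.Bundles using (_⇔_)

-- Finite (simple, undirected) graphs, given by a vertex type, a list
-- enumerating every vertex exactly once, and an adjacency relation.

record Graph : Set₁ where
  field
    V        : Set
    vertices : List V
    _~_      : V → V → Set

-- A colouring / vertex subset: true = blue (in the set).
Colouring : Graph → Set
Colouring G = Graph.V G → Bool

countTrue : {A : Set} → (A → Bool) → List A → ℕ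
countTrue S []       = 0
countTrue S (x ∷ xs) = (if S x then 1 else 0) + countTrue S xs

size : (G : Graph) → Colouring G → ℕ
size G S = countTrue S (Graph.vertices G)

Force : (G : Graph) → Colouring G → Colouring G → Set
Force G B B' =
  Σ V λ u → Σ V λ v →
    (B u ≡ true) × (u ~ v) × (B v ≡ false) ×
    (∀ w → u ~ w → w ≢ v → B w ≡ true) ×
    (∀ x → (B' x ≡ true) ⇔ ((B x ≡ true) ⊎ (x ≡ v)))
  where open Graph G

IsZeroForcingSet : (G : Graph) → Colouring G → Set
IsZeroForcingSet G S =
  Σ (Colouring G) λ B → Star (Force G) S B × (∀ x → B x ≡ true)

IsZeroForcingNumber : (G : Graph) → ℕ → Set
IsZeroForcingNumber G k =
  (Σ (Colouring G) λ S → IsZeroForcingSet G S × size G S ≡ k) ×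
  (∀ S → IsZeroForcingSet G S → k ≤ size G S)

-- The web graph Wb(m,r).  Indices are 0-based: v_{i,j} of the paper is
-- inj₁ (i-1 , j-1), pendant p_i is inj₂ (i-1).

CycleAdj : (m : ℕ) → Fin m → Fin m → Set
CycleAdj m i i' =
  (suc (toℕ i) ≡ toℕ i') ⊎ (suc (toℕ i') ≡ toℕ i) ⊎
  ((toℕ i ≡ 0) × (suc (toℕ i') ≡ m)) ⊎ ((toℕ i' ≡ 0) × (suc (toℕ i) ≡ m))

PathAdj : (r : ℕ) → Fin r → Fin r → Set
PathAdj r j j' = (suc (toℕ j) ≡ toℕ j') ⊎ (suc (toℕ j') ≡ toℕ j)

WbV : ℕ → ℕ → Set
WbV m r = (Fin m × Fin r) ⊎ Fin m

WbAdj : (m r : ℕ) → WbV m r → WbV m r → Set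
WbAdj m r (inj₁ (i , j)) (inj₁ (i' , j')) =
  ((i ≡ i') × PathAdj r j j') ⊎ ((j ≡ j') × CycleAdj m i i')
WbAdj m r (inj₁ (i , j)) (inj₂ i') = (i ≡ i') × (toℕ j ≡ 0)
WbAdj m r (inj₂ i) (inj₁ (i' , j)) = (i ≡ i') × (toℕ j ≡ 0)
WbAdj m r (inj₂ i) (inj₂ i')       = ⊥

WbVertices : (m r : ℕ) → List (WbV m r)
WbVertices m r =
  concatMap (λ i → map (λ j → inj₁ (i , j)) (allFin r)) (allFin m)
  ++ map inj₂ (allFin m)

Wb : ℕ → ℕ → Graph
Wb m r = record { V = WbV m r ; vertices = WbVertices m r ; _~_ = WbAdj m r }

{-# OPTIONS --safe #-}
-- The m pendant vertices already form a zero forcing set, whatever m and r: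
-- p_i forces v_{i,1}, and once layers 1, …, j-1 are blue together with
-- v_{1,j}, …, v_{i-1,j}, the vertex v_{i,j-1} has v_{i,j} as its only white
-- neighbour.
module Submission where

open import Defs
open import Data.Nat using (ℕ; zero; suc; _+_; _*_; _≤_; _<_; _<?_; z≤n; s≤s)
open import Data.Nat.Properties
  using ( ≤-refl; ≤-trans; <-trans; +-assoc; m≤n⇒m≤1+n; m<n⇒m<1+n; m<1+n⇒m<n∨m≡n; n<1+n; n≮n
        ; module ≤-Reasoning)
open import Data.Fin using (Fin; toℕ; fromℕ<; combine; inject₁)
open import Data.Fin.Properties
  using ( toℕ-injective; toℕ<n; toℕ-fromℕ<; toℕ-inject₁
        ; combine-injective; combine-surjective; combine-monoˡ-<)
open import Data.Bool using (Bool; true; false; if_then_else_)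
open import Data.List using (List; []; _∷_; _++_; map; concatMap; allFin; length)
open import Data.List.Properties using (length-map; length-tabulate)
open import Data.List.Relation.Unary.All using (All; []; _∷_; universal)
open import Data.List.Relation.Unary.All.Properties using (concat⁺; map⁺)
open import Data.Product using (Σ; ∃; _×_; _,_)
open import Data.Sum using (_⊎_; inj₁; inj₂)
open import Data.Empty using (⊥-elim)
open import Function using (id)
open import Function.Bundles using (_⇔_; mk⇔)
open import Relation.Nullary using (Dec; does; yes; no)
open import Relation.Nullary.Decidable using (dec-true; dec-false)
open import Relation.Binary.PropositionalEquality using (_≡_; _≢_; refl; sym; trans; cong; subst)
open import Relation.Binary.Construct.Closure.ReflexiveTransitive using (Star; ε; _◅_; _◅◅_)

does-true⇒ : {A : Set} (a? : Dec A) → does a? ≡ true → A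
does-true⇒ (yes a) _ = a
does-true⇒ (no _) ()

toℕ≡0⊎∃pred : ∀ {n} (j : Fin n) → toℕ j ≡ 0 ⊎ Σ (Fin n) λ j′ → suc (toℕ j′) ≡ toℕ j
toℕ≡0⊎∃pred Fin.zero    = inj₁ refl
toℕ≡0⊎∃pred (Fin.suc j) = inj₂ (inject₁ j , cong suc (toℕ-inject₁ j))

countTrue-++ : {A : Set} (S : A → Bool) (xs ys : List A) →
  countTrue S (xs ++ ys) ≡ countTrue S xs + countTrue S ys
countTrue-++ S []       ys = refl
countTrue-++ S (x ∷ xs) ys =
  trans (cong ((if S x then 1 else 0) +_) (countTrue-++ S xs ys))
        (sym (+-assoc (if S x then 1 else 0) (countTrue S xs) (countTrue S ys)))

countTrue≤length : {A : Set} (S : A → Bool) (xs : List A) → countTrue S xs ≤ length xs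
countTrue≤length S []       = z≤n
countTrue≤length S (x ∷ xs) with S x
... | true  = s≤s (countTrue≤length S xs)
... | false = m≤n⇒m≤1+n (countTrue≤length S xs)

countTrue-none : {A : Set} {S : A → Bool} {xs : List A} →
  All (λ x → S x ≡ false) xs → countTrue S xs ≡ 0
countTrue-none []                 = refl
countTrue-none (Sx≡false ∷ Sxs≡false) rewrite Sx≡false = countTrue-none Sxs≡false

forcingChain : {G : Graph} (B : ℕ → Colouring G) (n : ℕ) →
  (∀ k → k < n → Force G (B k) (B (suc k))) → Star (Force G) (B 0) (B n)
forcingChain     B zero    _     = ε
forcingChain {G} B (suc n) force =
  forcingChain {G} B n (λ k k<n → force k (m<n⇒m<1+n k<n)) ◅◅ (force n ≤-refl ◅ ε)

module Web (m r : ℕ) where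

  -- Grid vertices are forced layer by layer: v = (i , j) has rank m·j + i.
  rank : Fin m × Fin r → ℕ
  rank (i , j) = toℕ (combine j i)

  rank-injective : ∀ v w → rank v ≡ rank w → v ≡ w
  rank-injective (i , j) (i′ , j′) eq with combine-injective j i j′ i′ (toℕ-injective eq)
  ... | refl , refl = refl

  rank-surjective : ∀ n → n < r * m → ∃ λ v → rank v ≡ n
  rank-surjective n n<rm with combine-surjective (fromℕ< n<rm)
  ... | j , i , eq = (i , j) , trans (cong toℕ eq) (toℕ-fromℕ< n<rm)

  rank-monoˡ : ∀ {i i′ j j′} → toℕ j′ < toℕ j → rank (i′ , j′) < rank (i , j)
  rank-monoˡ {i} {i′} j′<j = combine-monoˡ-< i′ i j′<j

  stage : ℕ → Colouring (Wb m r)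
  stage n (inj₁ v) = does (rank v <? n)
  stage n (inj₂ _) = true

  stage-white : ∀ v → stage (rank v) (inj₁ v) ≡ false
  stage-white v = dec-false (rank v <? rank v) (n≮n (rank v))

  stage-lowerLayer : ∀ {i i′ j j′} → toℕ j′ < toℕ j → stage (rank (i , j)) (inj₁ (i′ , j′)) ≡ true
  stage-lowerLayer j′<j = dec-true (_ <? _) (rank-monoˡ j′<j)

  stage-suc : ∀ v x → (stage (suc (rank v)) x ≡ true) ⇔ (stage (rank v) x ≡ true ⊎ x ≡ inj₁ v)
  stage-suc v (inj₂ _) = mk⇔ inj₁ (λ _ → refl)
  stage-suc v (inj₁ w) = mk⇔ to from
    where
    to : does (rank w <? suc (rank v)) ≡ true → does (rank w <? rank v) ≡ true ⊎ inj₁ w ≡ inj₁ v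
    to blue with m<1+n⇒m<n∨m≡n (does-true⇒ (rank w <? suc (rank v)) blue)
    ... | inj₁ w<v = inj₁ (dec-true (rank w <? rank v) w<v)
    ... | inj₂ w≡v = inj₂ (cong inj₁ (rank-injective w v w≡v))
    from : does (rank w <? rank v) ≡ true ⊎ inj₁ w ≡ inj₁ v → does (rank w <? suc (rank v)) ≡ true
    from (inj₁ blue) = dec-true (rank w <? suc (rank v)) (m<n⇒m<1+n (does-true⇒ (rank w <? rank v) blue))
    from (inj₂ refl) = dec-true (rank w <? suc (rank v)) (n<1+n (rank v))

  sameColumn : ∀ {i j j′} → toℕ j ≡ toℕ j′ → _≡_ {A = WbV m r} (inj₁ (i , j)) (inj₁ (i , j′))
  sameColumn {i} eq = cong (λ j → inj₁ (i , j)) (toℕ-injective eq)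

  force-at : ∀ v → Force (Wb m r) (stage (rank v)) (stage (suc (rank v)))
  force-at (i , j) with toℕ≡0⊎∃pred j
  ... | inj₁ j≡0 =
    inj₂ i , inj₁ (i , j) , refl , (refl , j≡0) , stage-white (i , j) , onlyNeighbour , stage-suc (i , j)
    where
    onlyNeighbour : ∀ w → WbAdj m r (inj₂ i) w → w ≢ inj₁ (i , j) → stage (rank (i , j)) w ≡ true
    onlyNeighbour (inj₁ (_ , j′)) (refl , j′≡0) w≢v = ⊥-elim (w≢v (sameColumn (trans j′≡0 (sym j≡0))))
  ... | inj₂ (j′ , j′+1≡j) =
    inj₁ (i , j′) , inj₁ (i , j) , stage-lowerLayer j′<j , inj₁ (refl , inj₁ j′+1≡j) ,
    stage-white (i , j) , otherNeighbours , stage-suc (i , j)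
    where
    j′<j : toℕ j′ < toℕ j
    j′<j = subst (toℕ j′ <_) j′+1≡j (n<1+n (toℕ j′))
    otherNeighbours : ∀ w → WbAdj m r (inj₁ (i , j′)) w → w ≢ inj₁ (i , j) → stage (rank (i , j)) w ≡ true
    otherNeighbours (inj₂ _) _ _ = refl
    otherNeighbours (inj₁ _) (inj₂ (refl , _)) _ = stage-lowerLayer j′<j
    otherNeighbours (inj₁ _) (inj₁ (refl , inj₁ j′+1≡j″)) w≢v =
      ⊥-elim (w≢v (sameColumn (trans (sym j′+1≡j″) j′+1≡j)))
    otherNeighbours (inj₁ (_ , j″)) (inj₁ (refl , inj₂ j″+1≡j′)) _ =
      stage-lowerLayer (<-trans (subst (toℕ j″ <_) j″+1≡j′ (n<1+n (toℕ j″))) j′<j)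

  force : ∀ n → n < r * m → Force (Wb m r) (stage n) (stage (suc n))
  force n n<rm with rank-surjective n n<rm
  ... | v , refl = force-at v

  stage-final : ∀ x → stage (r * m) x ≡ true
  stage-final (inj₁ (i , j)) = dec-true (_ <? r * m) (toℕ<n (combine j i))
  stage-final (inj₂ _)       = refl

  stage0-isZeroForcingSet : IsZeroForcingSet (Wb m r) (stage 0)
  stage0-isZeroForcingSet = stage (r * m) , forcingChain {Wb m r} stage (r * m) force , stage-final

  size-stage0≤m : size (Wb m r) (stage 0) ≤ m
  size-stage0≤m = begin
    countTrue (stage 0) (grid ++ pendants)                ≡⟨ countTrue-++ (stage 0) grid pendants ⟩
    countTrue (stage 0) grid + countTrue (stage 0) pendants
      ≡⟨ cong (_+ countTrue (stage 0) pendants) (countTrue-none gridWhite) ⟩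
    countTrue (stage 0) pendants                          ≤⟨ countTrue≤length (stage 0) pendants ⟩
    length pendants                                       ≡⟨ length-map inj₂ (allFin m) ⟩
    length (allFin m)                                     ≡⟨ length-tabulate id ⟩
    m                                                     ∎
    where
    open ≤-Reasoning
    grid : List (WbV m r)
    grid = concatMap (λ i → map (λ j → inj₁ (i , j)) (allFin r)) (allFin m)
    pendants : List (WbV m r)
    pendants = map inj₂ (allFin m)
    gridWhite : All (λ x → stage 0 x ≡ false) grid
    gridWhite = concat⁺ (map⁺ (universal (λ i → map⁺ (universal (λ j → white i j) (allFin r))) (allFin m)))
      where
      white : ∀ i j → stage 0 (inj₁ (i , j)) ≡ false
      white i j = dec-false (rank (i , j) <? 0) (λ ())

mainTheorem5 : (m r : ℕ) → 3 ≤ m → 1 ≤ r → m ≤ 2 * r →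
    (k : ℕ) → IsZeroForcingNumber (Wb m r) k → k ≤ m
mainTheorem5 m r _ _ _ k (_ , minimal) =
  ≤-trans (minimal (stage 0) stage0-isZeroForcingSet) size-stage0≤m
  where open Web m r
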